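{- Let $\sigma : \mathcal{S} \to \mathcal{A}$ be a strong-receptive courteous pre-$\sim$-strategy on a thin concurrent game $\mathcal{A}$. Then $\mathcal{S}$ is race-preserving as well.
   Context: Essps are event structures with polarities equipped with a symmetry, presented as an isomorphism family $\mathbb{S}_A$ of bijections between configurations, or as a span $A\xleftarrow{l_A}\tilde A\xrightarrow{r_A}A$ whose configurations are those bijections ($l_A$, $r_A$ return domain/codomain). An essp $\mathcal{A}$ is race-preserving if $l_A$ preserves races: whenever a configuration $\theta$ of $\tilde A$ has single-event extensions by a negative pair and by a positive pair which are not jointly consistent in $\tilde A$, their left projections are not jointly consistent in $A$ either. A thin concurrent game is an essp which is race-preserving and has receptive thin sub-symmetries $\tilde A_-$ of $\mathcal{A}^\perp$ and $\tilde A_+$ of $\mathcal{A}$. A pre-$\sim$-strategy is a map of essps; it is courteous if whenever $s_1<s_2$ in $S$ with nothing strictly in between and ${\it pol}(s_1)=+$ or ${\it pol}(s_2)=-$, then $\sigma s_1<\sigma s_2$ with nothing strictly in between; strong-receptive if for every $\theta\in\mathbb{S}_S$, each extension of $\sigma\theta$ in $\mathbb{S}_A$ by a pair $(a_1,a_2)$ of negative events lifts to a unique extension $\theta\cup\{(s_1,s_2)\}\in\mathbb{S}_S$ with $\sigma s_i=a_i$. -}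

module Defs where

open import Data.List using (List; []; _∷_; map; [_])
open import Data.List.Membership.Propositional using (_∈_; _∉_)
open import Data.List.Relation.Binary.Subset.Propositional using (_⊆_)
open import Data.Product using (Σ; Σ-syntax; ∃; _×_; _,_; proj₁; proj₂; swap)
open import Relation.Binary.PropositionalEquality using (_≡_; _≢_; cong)
open import Relation.Nullary using (¬_)
open import Data.Sum using (_⊎_)

-- Finite sets are represented by lists, considered up to having the
-- same members.

_≈ˢ_ : {X : Set} → List X → List X → Set
xs ≈ˢ ys = (xs ⊆ ys) × (ys ⊆ xs)

data Pol : Set where
  pos neg : Pol

flip : Pol → Pol
flip pos = neg
flip neg = pos

record EventStructure : Set₁ where
  field
    E        : Set
    _≤_      : E → E → Set
    ≤-refl   : ∀ {e} → e ≤ e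
    ≤-trans  : ∀ {e e' e''} → e ≤ e' → e' ≤ e'' → e ≤ e''
    ≤-antisym : ∀ {e e'} → e ≤ e' → e' ≤ e → e ≡ e'
    causes   : E → List E
    causes-≤ : ∀ {e e'} → e' ≤ e → e' ∈ causes e
    causes-∈ : ∀ {e e'} → e' ∈ causes e → e' ≤ e
    Con      : List E → Set
    Con-resp : ∀ {X Y} → X ≈ˢ Y → Con X → Con Y
    Con-sing : ∀ e → Con [ e ]
    Con-sub  : ∀ {X Y} → Y ⊆ X → Con X → Con Y
    Con-down : ∀ {X e e'} → Con X → e ≤ e' → e' ∈ X → Con (e ∷ X)

  _<_ : E → E → Set
  e < e' = (e ≤ e') × (e ≢ e')

  _⋖_ : E → E → Set
  e ⋖ e' = (e < e') × (∀ e'' → ¬ ((e < e'') × (e'' < e')))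

  IsConfig : List E → Set
  IsConfig x = Con x × (∀ {e e'} → e' ≤ e → e ∈ x → e' ∈ x)

open EventStructure public

Rel : EventStructure → Set
Rel A = List (E A × E A)

dom : {A : EventStructure} → Rel A → List (E A)
dom θ = map proj₁ θ

cod : {A : EventStructure} → Rel A → List (E A)
cod θ = map proj₂ θ

idRel : {A : EventStructure} → List (E A) → Rel A
idRel x = map (λ e → e , e) x

invRel : {A : EventStructure} → Rel A → Rel A
invRel θ = map swap θ

IsBij : {A : EventStructure} → Rel A → Set
IsBij {A} θ =
  (∀ {a b b'} → (a , b) ∈ θ → (a , b') ∈ θ → b ≡ b') ×
  (∀ {a a' b} → (a , b) ∈ θ → (a' , b) ∈ θ → a ≡ a')

IsComposite : {A : EventStructure} → Rel A → Rel A → Rel A → Set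
IsComposite {A} θ φ ψ =
  ∀ a c → (((a , c) ∈ ψ → Σ[ b ∈ E A ] ((a , b) ∈ θ × (b , c) ∈ φ)) ×
           (∀ b → (a , b) ∈ θ → (b , c) ∈ φ → (a , c) ∈ ψ))

record IsIsoFamily (A : EventStructure) (S : Rel A → Set) : Set where
  field
    S-resp     : ∀ {θ θ'} → θ ≈ˢ θ' → S θ → S θ'
    S-bij      : ∀ {θ} → S θ → IsBij {A} θ
    S-domConf  : ∀ {θ} → S θ → IsConfig A (dom {A} θ)
    S-codConf  : ∀ {θ} → S θ → IsConfig A (cod {A} θ)
    S-id       : ∀ {x} → IsConfig A x → S (idRel {A} x)
    S-inv      : ∀ {θ} → S θ → S (invRel {A} θ)
    S-comp     : ∀ {θ φ ψ} → S θ → S φ → cod {A} θ ≈ˢ dom {A} φ →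
                 IsComposite {A} θ φ ψ → S ψ
    S-restrict : ∀ {θ x} → S θ → IsConfig A x → x ⊆ dom {A} θ →
                 Σ[ θ' ∈ Rel A ] ((θ' ⊆ θ) × S θ' × (dom {A} θ' ≈ˢ x))
    S-extend   : ∀ {θ x} → S θ → IsConfig A x → dom {A} θ ⊆ x →
                 Σ[ θ' ∈ Rel A ] ((θ ⊆ θ') × S θ' × (dom {A} θ' ≈ˢ x))

record ESSP : Set₁ where
  field
    ES      : EventStructure
    pol     : E ES → Pol
    Sym     : Rel ES → Set
    isIsoFamily : IsIsoFamily ES Sym
    Sym-pol : ∀ {θ a b} → Sym θ → (a , b) ∈ θ → pol a ≡ pol b

  Ev : Set
  Ev = E ES

open ESSP public

_⊥ : ESSP → ESSP
A ⊥ = record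
  { ES = ES A ; pol = λ e → flip (pol A e) ; Sym = Sym A
  ; isIsoFamily = isIsoFamily A
  ; Sym-pol = λ s m → cong flip (Sym-pol A s m) }

Ext : (A : ESSP) → (Rel (ES A) → Set) → Rel (ES A) → Ev A → Ev A → Set
Ext A S θ a₁ a₂ = (a₁ ∉ dom {ES A} θ) × S ((a₁ , a₂) ∷ θ)

-- Race-preservation (l_A preserves races), phrased on the
-- isomorphism family: configurations of Ã are the θ ∈ 𝕊_A.

RacePreserving : ESSP → Set
RacePreserving A =
  ∀ θ a₁ a₂ b₁ b₂ → Sym A θ →
  Ext A (Sym A) θ a₁ a₂ → pol A a₁ ≡ neg →
  Ext A (Sym A) θ b₁ b₂ → pol A b₁ ≡ pos →
  ¬ Sym A ((a₁ , a₂) ∷ (b₁ , b₂) ∷ θ) →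
  ¬ Con (ES A) (a₁ ∷ b₁ ∷ dom {ES A} θ)

IsSubSymmetry : (A : ESSP) → (Rel (ES A) → Set) → Set
IsSubSymmetry A S' = IsIsoFamily (ES A) S' × (∀ {θ} → S' θ → Sym A θ)

IsThin : (A : ESSP) → (Rel (ES A) → Set) → Set
IsThin A S' =
  ∀ x a a' → IsConfig (ES A) x → S' ((a , a') ∷ idRel {ES A} x) →
  pol A a ≡ pos → a ≡ a'

IsReceptive : (A : ESSP) → (Rel (ES A) → Set) → Set
IsReceptive A S' =
  ∀ θ θ' → S' θ → θ ⊆ θ' → Sym A θ' →
  (∀ {a b} → (a , b) ∈ θ' → (a , b) ∉ θ → pol A a ≡ neg) → S' θ'

record ThinConcurrentGame : Set₁ where
  field
    game       : ESSP
    racePres   : RacePreserving game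
    SymMinus   : Rel (ES game) → Set
    SymPlus    : Rel (ES game) → Set
    minus-sub  : IsSubSymmetry (game ⊥) SymMinus
    minus-thin : IsThin (game ⊥) SymMinus
    minus-rec  : IsReceptive (game ⊥) SymMinus
    plus-sub   : IsSubSymmetry game SymPlus
    plus-thin  : IsThin game SymPlus
    plus-rec   : IsReceptive game SymPlus

mapRel : {A B : EventStructure} → (E A → E B) → Rel A → Rel B
mapRel f θ = map (λ p → f (proj₁ p) , f (proj₂ p)) θ

record ESSPMap (S A : ESSP) : Set where
  field
    fun       : Ev S → Ev A
    pres-conf : ∀ {x} → IsConfig (ES S) x → IsConfig (ES A) (map fun x)
    loc-inj   : ∀ {x s s'} → IsConfig (ES S) x → s ∈ x → s' ∈ x →
                fun s ≡ fun s' → s ≡ s'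
    pres-pol  : ∀ s → pol A (fun s) ≡ pol S s
    pres-sym  : ∀ {θ} → Sym S θ → Sym A (mapRel {ES S} {ES A} fun θ)

open ESSPMap public

Courteous : {S A : ESSP} → ESSPMap S A → Set
Courteous {S} {A} σ =
  ∀ s₁ s₂ → _⋖_ (ES S) s₁ s₂ → (pol S s₁ ≡ pos) ⊎ (pol S s₂ ≡ neg) →
  _⋖_ (ES A) (fun σ s₁) (fun σ s₂)

StrongReceptive : {S A : ESSP} → ESSPMap S A → Set
StrongReceptive {S} {A} σ =
  ∀ θ → Sym S θ → ∀ a₁ a₂ → pol A a₁ ≡ neg →
  Ext A (Sym A) (mapRel {ES S} {ES A} (fun σ) θ) a₁ a₂ →
  Σ[ s₁ ∈ Ev S ] Σ[ s₂ ∈ Ev S ]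
    (((fun σ s₁ ≡ a₁) × (fun σ s₂ ≡ a₂) × Ext S (Sym S) θ s₁ s₂) ×
     (∀ s₁' s₂' → fun σ s₁' ≡ a₁ → fun σ s₂' ≡ a₂ → Ext S (Sym S) θ s₁' s₂' →
        (s₁' ≡ s₁) × (s₂' ≡ s₂)))

module Submission where

-- Suppose a negative extension (a₁ , a₂) and a positive extension (b₁ , b₂) of θ ∈ 𝕊_S
-- are consistent but not jointly symmetric. Their images are consistent, so by race
-- preservation of the game they are jointly symmetric there. Strong receptivity lifts
-- (σ a₁ , σ a₂) along the symmetry extending θ by (b₁ , b₂), to some (s₁ , s₂). By
-- courtesy s₁ cannot depend on the positive b₁, so (s₁ , s₂) already extends θ, and
-- uniqueness of lifts gives (s₁ , s₂) = (a₁ , a₂): the two extensions were jointly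
-- symmetric after all.

open import Defs hiding (_≤_; _<_; _⋖_; IsConfig; Con)
open import Data.List using (List; []; _∷_; map)
open import Data.List.Membership.Propositional using (_∈_; _∉_)
open import Data.List.Membership.Propositional.Properties using (∈-map⁺; ∈-map⁻)
open import Data.List.Relation.Unary.Any using (here; there)
open import Data.List.Relation.Binary.Subset.Propositional using (_⊆_)
open import Data.List.Relation.Binary.Subset.Propositional.Properties using (⊆-reflexive-↭; ∷⁺ʳ)
open import Data.List.Relation.Binary.Permutation.Propositional using (↭-swap; ↭-refl)
open import Data.Product using (_×_; _,_; proj₁; proj₂)
open import Data.Sum using (inj₁)
open import Data.Empty using (⊥-elim)
open import Function using (_∘_)
open import Relation.Nullary using (¬_)
open import Relation.Binary.PropositionalEquality

neg≢pos : neg ≢ pos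
neg≢pos ()

∷-swap-≈ˢ : {X : Set} {x y : X} {zs : List X} → (x ∷ y ∷ zs) ≈ˢ (y ∷ x ∷ zs)
∷-swap-≈ˢ = ⊆-reflexive-↭ (↭-swap _ _ ↭-refl) , ⊆-reflexive-↭ (↭-swap _ _ ↭-refl)

dom-mapRel : {S A : EventStructure} (f : E S → E A) (θ : Rel S) →
             dom {A} (mapRel {S} {A} f θ) ≡ map f (dom {S} θ)
dom-mapRel f [] = refl
dom-mapRel {S} {A} f (p ∷ θ) = cong (f (proj₁ p) ∷_) (dom-mapRel {S} {A} f θ)

module ConfigurationProperties (𝒳 : EventStructure) where
  open EventStructure 𝒳 using (_≤_; _<_; _⋖_; IsConfig; Con)

  strict-cause-∈ : ∀ {a b xs} → IsConfig (a ∷ xs) → b < a → b ∈ xs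
  strict-cause-∈ (_ , down) (b≤a , b≢a) with down b≤a (here refl)
  ... | here b≡a = ⊥-elim (b≢a b≡a)
  ... | there b∈xs = b∈xs

  IsConfig-∷-∷ : ∀ {a b xs} → IsConfig (a ∷ xs) → IsConfig (b ∷ xs) →
                 Con (a ∷ b ∷ xs) → IsConfig (a ∷ b ∷ xs)
  IsConfig-∷-∷ {a} {b} {xs} (_ , down-a) (_ , down-b) con = con , down
    where
    down : ∀ {e e'} → e' ≤ e → e ∈ a ∷ b ∷ xs → e' ∈ a ∷ b ∷ xs
    down e'≤e (here refl) = ∷⁺ʳ a there (down-a e'≤e (here refl))
    down e'≤e (there (here refl)) = there (down-b e'≤e (here refl))
    down e'≤e (there (there e∈xs)) = ∷⁺ʳ a there (down-a e'≤e (there e∈xs))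

  IsConfig-drop : ∀ {a b xs} → IsConfig (a ∷ b ∷ xs) → IsConfig xs → ¬ b ≤ a →
                  IsConfig (a ∷ xs)
  IsConfig-drop {a} {b} {xs} (con , down) (_ , down-xs) b≰a = Con-sub 𝒳 (∷⁺ʳ a there) con , down′
    where
    down′ : ∀ {e e'} → e' ≤ e → e ∈ a ∷ xs → e' ∈ a ∷ xs
    down′ e'≤a (here refl) with down e'≤a (here refl)
    ... | here e'≡a = here e'≡a
    ... | there (here refl) = ⊥-elim (b≰a e'≤a)
    ... | there (there e'∈xs) = there e'∈xs
    down′ e'≤e (there e∈xs) = there (down-xs e'≤e e∈xs)

  <⇒⋖ : ∀ {a b xs} → IsConfig (a ∷ b ∷ xs) → IsConfig xs → b ∉ xs → b < a → b ⋖ a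
  <⇒⋖ {a} {b} a-config (_ , down-xs) b∉xs b<a = b<a , nothing-between
    where
    nothing-between : ∀ e → ¬ (b < e × e < a)
    nothing-between e ((b≤e , b≢e) , e<a) with strict-cause-∈ a-config e<a
    ... | here e≡b = b≢e (sym e≡b)
    ... | there e∈xs = b∉xs (down-xs b≤e e∈xs)

open ConfigurationProperties

module IsoFamilyProperties {𝒳 : EventStructure} {𝕊 : Rel 𝒳 → Set}
                           (isIso : IsIsoFamily 𝒳 𝕊) where
  open IsIsoFamily isIso
  open EventStructure 𝒳 using (IsConfig)

  drop-pair : ∀ {q θ} → 𝕊 (q ∷ θ) → proj₁ q ∉ dom {𝒳} θ → IsConfig (dom {𝒳} θ) → 𝕊 θ
  drop-pair {q} {θ} qθ∈𝕊 q∉θ θ-config with S-restrict qθ∈𝕊 θ-config there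
  ... | θ' , θ'⊆qθ , θ'∈𝕊 , dom⊆ , dom⊇ = S-resp (θ'⊆θ , θ⊆θ') θ'∈𝕊
    where
    θ'⊆θ : θ' ⊆ θ
    θ'⊆θ p∈θ' with θ'⊆qθ p∈θ'
    ... | here refl = ⊥-elim (q∉θ (dom⊆ (∈-map⁺ proj₁ p∈θ')))
    ... | there p∈θ = p∈θ
    θ⊆θ' : θ ⊆ θ'
    θ⊆θ' {x , y} xy∈θ with ∈-map⁻ proj₁ (dom⊇ (∈-map⁺ proj₁ xy∈θ))
    ... | (_ , y') , xy'∈θ' , refl =
      subst (λ z → (x , z) ∈ θ') (proj₁ (S-bij qθ∈𝕊) (θ'⊆qθ xy'∈θ') (there xy∈θ)) xy'∈θ'

open IsoFamilyProperties

module StrategyProperties {S A : ESSP} (σ : ESSPMap S A) where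
  private
    module S = EventStructure (ES S)
    module A = EventStructure (ES A)
    module 𝕊S = IsIsoFamily (isIsoFamily S)
    f : Ev S → Ev A
    f = fun σ
    image : Rel (ES S) → Rel (ES A)
    image = mapRel {ES S} {ES A} f

  fun-∉-map : ∀ {s xs} → S.IsConfig (s ∷ xs) → s ∉ xs → f s ∉ map f xs
  fun-∉-map s-config s∉xs fs∈ with ∈-map⁻ f fs∈
  ... | s' , s'∈xs , fs≡fs' =
    s∉xs (subst (_∈ _) (sym (loc-inj σ s-config (here refl) (there s'∈xs) fs≡fs')) s'∈xs)

  image-Ext : ∀ {θ s₁ s₂} → Ext S (Sym S) θ s₁ s₂ → Ext A (Sym A) (image θ) (f s₁) (f s₂)
  image-Ext {θ} (s₁∉θ , ext∈𝕊) =
    subst (f _ ∉_) (sym (dom-mapRel {ES S} {ES A} f θ))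
          (fun-∉-map (𝕊S.S-domConf ext∈𝕊) s₁∉θ) ,
    pres-sym σ ext∈𝕊

  lift-unique : StrongReceptive σ → ∀ {θ a₁ a₂ s₁ s₂} → Sym S θ → pol S a₁ ≡ neg →
                Ext S (Sym S) θ a₁ a₂ → Ext S (Sym S) θ s₁ s₂ →
                f s₁ ≡ f a₁ → f s₂ ≡ f a₂ → s₁ ≡ a₁ × s₂ ≡ a₂
  lift-unique sr {θ} {a₁} {a₂} θ∈𝕊 a-neg a-ext s-ext fs₁≡fa₁ fs₂≡fa₂
    with sr θ θ∈𝕊 (f a₁) (f a₂) (trans (pres-pol σ a₁) a-neg) (image-Ext a-ext)
  ... | _ , _ , _ , unique
    with unique _ _ refl refl a-ext | unique _ _ fs₁≡fa₁ fs₂≡fa₂ s-ext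
  ... | a₁≡t₁ , a₂≡t₂ | s₁≡t₁ , s₂≡t₂ = trans s₁≡t₁ (sym a₁≡t₁) , trans s₂≡t₂ (sym a₂≡t₂)

  courteous-drop : Courteous σ → ∀ {θ b₁ b₂ s₁ s₂} → Sym S θ →
                   Ext S (Sym S) θ b₁ b₂ → pol S b₁ ≡ pos →
                   Ext S (Sym S) ((b₁ , b₂) ∷ θ) s₁ s₂ →
                   A.IsConfig (f s₁ ∷ map f (dom {ES S} θ)) →
                   Ext S (Sym S) θ s₁ s₂
  courteous-drop co {θ} {b₁} {b₂} {s₁} θ∈𝕊 (b₁∉θ , bθ∈𝕊) b-pos (s₁∉bθ , sbθ∈𝕊) fs₁-config =
    s₁∉bθ ∘ there ,
    drop-pair (isIsoFamily S) (𝕊S.S-resp ∷-swap-≈ˢ sbθ∈𝕊) b₁∉sθ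
              (IsConfig-drop (ES S) sbθ-config θ-config b₁≰s₁)
    where
    θ-config : S.IsConfig (dom {ES S} θ)
    θ-config = 𝕊S.S-domConf θ∈𝕊
    sbθ-config : S.IsConfig (s₁ ∷ b₁ ∷ dom {ES S} θ)
    sbθ-config = 𝕊S.S-domConf sbθ∈𝕊
    b₁≢s₁ : b₁ ≢ s₁
    b₁≢s₁ b₁≡s₁ = s₁∉bθ (here (sym b₁≡s₁))
    b₁∉sθ : b₁ ∉ s₁ ∷ dom {ES S} θ
    b₁∉sθ (here b₁≡s₁) = b₁≢s₁ b₁≡s₁
    b₁∉sθ (there b₁∈θ) = b₁∉θ b₁∈θ
    -- Courtesy would transport b₁ ⋖ s₁ to the game, but the causes of f s₁ lie in the
    -- image of θ, which misses f b₁.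
    b₁≰s₁ : ¬ b₁ S.≤ s₁
    b₁≰s₁ b₁≤s₁ =
      fun-∉-map (𝕊S.S-domConf bθ∈𝕊) b₁∉θ (strict-cause-∈ (ES A) fs₁-config (proj₁ fb₁⋖fs₁))
      where
      fb₁⋖fs₁ : f b₁ A.⋖ f s₁
      fb₁⋖fs₁ = co b₁ s₁ (<⇒⋖ (ES S) sbθ-config θ-config b₁∉θ (b₁≤s₁ , b₁≢s₁)) (inj₁ b-pos)

  joint-lift : StrongReceptive σ → Courteous σ → ∀ {θ a₁ a₂ b₁ b₂} → Sym S θ →
               Ext S (Sym S) θ a₁ a₂ → pol S a₁ ≡ neg →
               Ext S (Sym S) θ b₁ b₂ → pol S b₁ ≡ pos →
               Sym A ((f a₁ , f a₂) ∷ (f b₁ , f b₂) ∷ image θ) →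
               Sym S ((a₁ , a₂) ∷ (b₁ , b₂) ∷ θ)
  joint-lift sr co {θ} {a₁} {a₂} {b₁} {b₂} θ∈𝕊 a-ext a-neg b-ext b-pos joint∈𝕊
    with sr ((b₁ , b₂) ∷ θ) (proj₂ b-ext) (f a₁) (f a₂) fa₁-neg (fa₁∉bθ , joint∈𝕊)
    where
    fa₁-neg : pol A (f a₁) ≡ neg
    fa₁-neg = trans (pres-pol σ a₁) a-neg
    fa₁∉bθ : f a₁ ∉ dom {ES A} (image ((b₁ , b₂) ∷ θ))
    fa₁∉bθ (here fa₁≡fb₁) =
      neg≢pos (trans (sym fa₁-neg) (trans (cong (pol A) fa₁≡fb₁) (trans (pres-pol σ b₁) b-pos)))
    fa₁∉bθ (there fa₁∈θ) = proj₁ (image-Ext a-ext) fa₁∈θ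
  ... | s₁ , s₂ , (fs₁≡fa₁ , fs₂≡fa₂ , s-ext) , _
    with lift-unique sr θ∈𝕊 a-neg a-ext (courteous-drop co θ∈𝕊 b-ext b-pos s-ext s₁-config)
                     fs₁≡fa₁ fs₂≡fa₂
    where
    s₁-config : A.IsConfig (f s₁ ∷ map f (dom {ES S} θ))
    s₁-config = subst (λ x → A.IsConfig (x ∷ map f (dom {ES S} θ))) (sym fs₁≡fa₁)
                      (pres-conf σ (𝕊S.S-domConf (proj₂ a-ext)))
  ... | refl , refl = proj₂ s-ext

open StrategyProperties

lemma12 : (A : ThinConcurrentGame) (S : ESSP)
          (σ : ESSPMap S (ThinConcurrentGame.game A)) →
          StrongReceptive σ → Courteous σ → RacePreserving S
lemma12 A S σ sr co θ a₁ a₂ b₁ b₂ θ∈𝕊 a-ext a-neg b-ext b-pos ¬joint con =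
  racePres (mapRel {ES S} {ES game} f θ) (f a₁) (f a₂) (f b₁) (f b₂) (pres-sym σ θ∈𝕊)
           (image-Ext σ a-ext) (trans (pres-pol σ a₁) a-neg)
           (image-Ext σ b-ext) (trans (pres-pol σ b₁) b-pos)
           (¬joint ∘ joint-lift σ sr co θ∈𝕊 a-ext a-neg b-ext b-pos)
           image-con
  where
  open ThinConcurrentGame A using (game; racePres)
  open IsIsoFamily (isIsoFamily S) using (S-domConf)
  f : Ev S → Ev game
  f = fun σ
  image-con : EventStructure.Con (ES game) (f a₁ ∷ f b₁ ∷ dom {ES game} (mapRel {ES S} {ES game} f θ))
  image-con = subst (λ xs → EventStructure.Con (ES game) (f a₁ ∷ f b₁ ∷ xs))
                    (sym (dom-mapRel {ES S} {ES game} f θ))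
                    (proj₁ (pres-conf σ (IsConfig-∷-∷ (ES S) (S-domConf (proj₂ a-ext))
                                                            (S-domConf (proj₂ b-ext)) con)))
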